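{- Let $t\geq 5$ be an integer, and let $\mathcal{K}$ and $(T_K:K\in\mathcal{K})$ be as described in the context. Let $d$ be a positive integer, let $K\in\mathcal{K}$ and let $u\in V(T_K)$. Then there is a path $L$ in $K$ of length at most $t^{2d+3t}$ such that every $x\in V(K)$ with $\mathrm{dist}_{T_K}(u,x)<d$ belongs to $V(L)$.
   Context: Graphs are finite and simple; path length = number of edges; $\mathrm{dist}_G$ is shortest-path distance in $G$. Territories. A territory is a pair $(T,B)$ where $T$ is a graph and $B$ an induced cycle in $T$; its perimeter is the length of $B$. Expansion (w.r.t. $t$): given a territory $(T',B')$, choose for some $k\geq0$ a stable set $\{x_1,\dots,x_k\}$ of $B'$, let $x_i^-,x_i^+$ be the neighbours of $x_i$ in $B'$, and choose $I\subseteq\{1,\dots,k\}$. Build $T$ from $T'$: for each $i$ add a new path $P_i$ of length $2t-6$ with ends $y_i^-,y_i^+$ and middle vertex $y_i$, and edges $x_i^-y_i^-,x_iy_i,x_i^+y_i^+$; for each $i\in I$, with $v_i^-,v_i^+$ the neighbours of $y_i$ in $P_i$ ($v_i^-$ on the side of $y_i^-$), add a new path $Q_i$ of length $t-4$ with ends $z_i^-,z_i^+$ and edges $v_i^-z_i^-,v_i^+z_i^+$ (all new vertices distinct). For $i\notin I$, $R_i=x_i^-\text{ - }y_i^-\text{ - }P_i\text{ - }y_i^+\text{ - }x_i^+$; for $i\in I$, $R_i$ goes $x_i^-,y_i^-$, along $P_i$ to $v_i^-$, $z_i^-$, along $Q_i$ to $z_i^+$, $v_i^+$, along $P_i$ to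 $y_i^+$, $x_i^+$. Set $B=(B'\setminus\{x_1,\dots,x_k\})\cup\bigcup_iR_i$; $(T,B)$ is an expansion of $(T',B')$. The territories $(T_m,B_m)$: $T_0=B_0$ is a $t$-cycle; for $m\ge1$, with $N=t(t-3)^{m-1}$ and $B_{m-1}=x_1\text{ - }\cdots\text{ - }x_N\text{ - }x_1$, $T_m$ is obtained from $T_{m-1}$ by adding a new cycle $B_m$, the $(t-4)$-subdivision of an $N$-cycle $x_1'\text{ - }\cdots\text{ - }x_N'\text{ - }x_1'$ (each edge replaced by a path of length $t-3$), and the edges $x_ix_i'$. A territory $(T,B)$ is canonical if for some $m\ge0$ there is an expansion $(T',B')$ of $(T_m,B_m)$ and an isomorphism $T\to T'$ mapping $B$ isomorphically onto $B'$. Setting. Let $g=t^{5t}$ and let $\Gamma$ be a $3$-regular graph of girth at least $g$ with a Hamiltonian cycle $\Omega$. Let $(M_1,M_2)$ be a partition of $E(\Omega)$ into two perfect matchings of $\Gamma$ and $M_3=E(\Gamma)\setminus E(\Omega)$. For $i\in\{1,2,3\}$ let $\mathcal{K}_i$ be the set of components (cycles) of the spanning subgraph of $\Gamma$ with edge set $E(\Gamma)\setminus M_i$, and $\mathcal{K}=\mathcal{K}_1\cup\mathcal{K}_2\cup\mathcal{K}_3$. For each $K\in\mathcal{K}$ let $T_K$ be a graph such that $(T_K,K)$ is a canonical territory (of perimeter equal to the length of $K$), with $V(T_K)\cap V(\Gamma)=V(K)$, and such that $V(T_K)\cap V(T_{K'})=V(K)\cap V(K')$ for all distinct $K,K'\in\mathcal{K}$.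 -}

module Defs where

open import Data.Nat using (ℕ; zero; suc; _+_; _*_; _∸_; _^_; _≤_; _<_)
open import Data.Fin using (Fin)
open import Data.Bool using (Bool; true; false)
open import Data.Product using (Σ; ∃; ∃-syntax; _×_; _,_)
open import Data.Sum using (_⊎_)
open import Data.Empty using (⊥)
open import Data.List using (List; []; _∷_; length)
open import Data.List.Membership.Propositional using (_∈_)
open import Data.List.Relation.Unary.All using (All)
open import Data.List.Relation.Unary.Unique.Propositional using (Unique)
open import Data.List.Relation.Unary.Linked using (Linked)
open import Relation.Nullary using (¬_)
open import Relation.Binary.PropositionalEquality using (_≡_; _≢_)
open import Function.Bundles using (_⇔_)

-- Graphs over a common carrier type A: a vertex predicate and an edge
-- relation.  All graphs of the setting live over one carrier, so that
-- vertex sets of different graphs can be intersected.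

record Graph (A : Set) : Set₁ where
  field
    V : A → Set
    E : A → A → Set
open Graph public

record IsGraph {A : Set} (G : Graph A) : Set where
  field
    finite : ∃[ l ] (∀ x → V G x → x ∈ l)
    E-V    : ∀ {x y} → E G x y → V G x × V G y
    E-sym  : ∀ {x y} → E G x y → E G y x
    E-irr  : ∀ {x} → ¬ E G x x

SubGraph : {A : Set} → Graph A → Graph A → Set
SubGraph H G = (∀ x → V H x → V G x) × (∀ x y → E H x y → E G x y)

SameGraph : {A : Set} → Graph A → Graph A → Set
SameGraph G H = (∀ x → V G x ⇔ V H x) × (∀ x y → E G x y ⇔ E H x y)

-- Paths: a path is the list of its vertices (distinct, consecutive ones
-- adjacent); its length is the number of edges = (number of vertices) - 1.

IsPath : {A : Set} → Graph A → List A → Set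
IsPath G xs = All (V G) xs × Unique xs × Linked (E G) xs

lastOf : {A : Set} → A → List A → A
lastOf a [] = a
lastOf a (b ∷ bs) = lastOf b bs

-- dist_G(u,x) < d : there is a path from u to x in G of length < d
-- (dist is the minimum length of a u-x path, infinite if there is none)
DistLt : {A : Set} → Graph A → A → A → ℕ → Set
DistLt G u x d = ∃[ ys ] (IsPath G (u ∷ ys) × lastOf u ys ≡ x × length ys < d)

CycAdj : ℕ → ℕ → ℕ → Set
CycAdj n a b = (suc a ≡ b) ⊎ (suc b ≡ a) ⊎ (suc a ≡ n × b ≡ 0) ⊎ (suc b ≡ n × a ≡ 0)

IsCycle : {A : Set} → Graph A → Set
IsCycle {A} G =
  ∃[ n ] (3 ≤ n × Σ (ℕ → A) λ c →
     (∀ a b → a < n → b < n → c a ≡ c b → a ≡ b)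
   × (∀ x → V G x ⇔ (∃[ a ] (a < n × c a ≡ x)))
   × (∀ x y → E G x y ⇔ (∃[ a ] ∃[ b ] (a < n × b < n × c a ≡ x × c b ≡ y × CycAdj n a b))))

GirthAtLeast : {A : Set} → Graph A → ℕ → Set
GirthAtLeast {A} G g = ∀ n (c : ℕ → A) → 3 ≤ n
  → (∀ a b → a < n → b < n → c a ≡ c b → a ≡ b)
  → (∀ a → suc a < n → E G (c a) (c (suc a)))
  → E G (c (n ∸ 1)) (c 0)
  → g ≤ n

Cubic : {A : Set} → Graph A → Set
Cubic G = ∀ v → V G v → ∃[ a ] ∃[ b ] ∃[ c ]
  (a ≢ b × a ≢ c × b ≢ c × E G v a × E G v b × E G v c
   × (∀ w → E G v w → w ≡ a ⊎ w ≡ b ⊎ w ≡ c))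

HamiltonianCycle : {A : Set} → Graph A → Graph A → Set
HamiltonianCycle Γ Ω = IsCycle Ω × (∀ x → V Ω x ⇔ V Γ x) × (∀ x y → E Ω x y → E Γ x y)

PerfectMatching : {A : Set} → Graph A → (A → A → Set) → Set
PerfectMatching Γ M = (∀ x y → M x y → E Γ x y) × (∀ x y → M x y → M y x)
  × (∀ x → V Γ x → ∃[ y ] (M x y × (∀ z → M x z → z ≡ y)))

EdgePartition : {A : Set} → Graph A → (A → A → Set) → (A → A → Set) → Set
EdgePartition Ω M₁ M₂ = (∀ x y → E Ω x y ⇔ (M₁ x y ⊎ M₂ x y)) × (∀ x y → M₁ x y → M₂ x y → ⊥)

Complement : {A : Set} → Graph A → Graph A → (A → A → Set)
Complement Γ Ω x y = E Γ x y × ¬ E Ω x y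

DeleteEdges : {A : Set} → Graph A → (A → A → Set) → Graph A
DeleteEdges Γ M = record { V = V Γ ; E = λ x y → E Γ x y × ¬ M x y }

IsComponent : {A : Set} → Graph A → Graph A → Set
IsComponent H K =
    (∀ x → V K x → V H x)
  × (∃[ x ] V K x)
  × (∀ x y → V K x → V K y → ∃[ ys ] (IsPath K (x ∷ ys) × lastOf x ys ≡ y))
  × (∀ x y → V K x → E H x y → V K y)
  × (∀ x y → E K x y ⇔ (E H x y × V K x × V K y))

InCalK : {A : Set} → Graph A → Graph A → (A → A → Set) → (A → A → Set) → Graph A → Set
InCalK Γ Ω M₁ M₂ K =
    IsComponent (DeleteEdges Γ M₁) K
  ⊎ IsComponent (DeleteEdges Γ M₂) K
  ⊎ IsComponent (DeleteEdges Γ (Complement Γ Ω)) K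

-- Vertex (j , a) is the
-- a-th vertex (0-based, in cyclic order) of the cycle B_j, j ≤ m, which
-- has length L j = t (t-3)^j.  For j ≥ 1, x'_i of B_j is vertex (t-3)·i.

Len : ℕ → ℕ → ℕ
Len t j = t * (t ∸ 3) ^ j

Tm : ℕ → ℕ → Graph (ℕ × ℕ)
Tm t m = record
  { V = TV
  ; E = λ { (j , a) (j' , b) → TV (j , a) × TV (j' , b) ×
        ((j ≡ j' × CycAdj (Len t j) a b)
         ⊎ (j' ≡ suc j × b ≡ (t ∸ 3) * a)
         ⊎ (j ≡ suc j' × a ≡ (t ∸ 3) * b)) }
  }
  where
  TV : ℕ × ℕ → Set
  TV (j , a) = j ≤ m × a < Len t j

Bm : ℕ → ℕ → Graph (ℕ × ℕ)
Bm t m = record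
  { V = BV
  ; E = λ { (j , a) (j' , b) → BV (j , a) × BV (j' , b) × j ≡ j' × CycAdj (Len t j) a b }
  }
  where
  BV : ℕ × ℕ → Set
  BV (j , a) = j ≡ m × a < Len t j

record Expansion (t : ℕ) {A : Set} (T' B' : Graph A) : Set where
  field
    k      : ℕ
    x      : Fin k → A
    x⁻ x⁺  : Fin k → A
    I      : Fin k → Bool
    x-in   : ∀ i → V B' (x i)
    x-inj  : ∀ i j → x i ≡ x j → i ≡ j
    x-stab : ∀ i j → ¬ E B' (x i) (x j)
    x⁻-adj : ∀ i → E B' (x i) (x⁻ i)
    x⁺-adj : ∀ i → E B' (x i) (x⁺ i)
    x⁻≢x⁺  : ∀ i → x⁻ i ≢ x⁺ i

-- vertices of an expansion: old vertices, vertex number a of P_i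
-- (a = 0 is y_i⁻, a = 2t-6 is y_i⁺, a = t-3 is y_i, a = t-4 is v_i⁻,
-- a = t-2 is v_i⁺), vertex number b of Q_i (b = 0 is z_i⁻, b = t-4 is z_i⁺)
data XV (A : Set) (k : ℕ) : Set where
  old : A → XV A k
  pv  : Fin k → ℕ → XV A k
  qv  : Fin k → ℕ → XV A k

module _ (t : ℕ) {A : Set} {T' B' : Graph A} (D : Expansion t T' B') where
  open Expansion D

  ExpV : XV A k → Set
  ExpV (old a) = V T' a
  ExpV (pv i a) = a ≤ 2 * t ∸ 6
  ExpV (qv i b) = I i ≡ true × b ≤ t ∸ 4

  -- one orientation of each edge of T
  ExpEd : XV A k → XV A k → Set
  ExpEd (old a) (old b) = E T' a b
  ExpEd (pv i a) (pv j b) = i ≡ j × suc a ≡ b × b ≤ 2 * t ∸ 6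
  ExpEd (qv i a) (qv j b) = i ≡ j × I i ≡ true × suc a ≡ b × b ≤ t ∸ 4
  ExpEd (old a) (pv i b) =
    (a ≡ x⁻ i × b ≡ 0) ⊎ (a ≡ x i × b ≡ t ∸ 3) ⊎ (a ≡ x⁺ i × b ≡ 2 * t ∸ 6)
  ExpEd (pv i a) (qv j b) =
    i ≡ j × I i ≡ true × ((a ≡ t ∸ 4 × b ≡ 0) ⊎ (a ≡ t ∸ 2 × b ≡ t ∸ 4))
  ExpEd _ _ = ⊥

  ExpT : Graph (XV A k)
  ExpT = record { V = ExpV ; E = λ u v → ExpEd u v ⊎ ExpEd v u }

  ExpS : XV A k → Set
  ExpS (old a) = V B' a × (∀ i → a ≢ x i)
  ExpS (pv i a) = a ≤ 2 * t ∸ 6 × (I i ≡ true → a ≢ t ∸ 3)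
  ExpS (qv i b) = I i ≡ true × b ≤ t ∸ 4

  -- one orientation of each edge of B: edges of B' not incident with
  -- any x_i, and the edges of the paths R_i
  ExpEdB : XV A k → XV A k → Set
  ExpEdB (old a) (old b) = E B' a b × ExpS (old a) × ExpS (old b)
  ExpEdB (pv i a) (pv j b) =
    i ≡ j × suc a ≡ b × b ≤ 2 * t ∸ 6 × (I i ≡ true → a ≢ t ∸ 3 × b ≢ t ∸ 3)
  ExpEdB (qv i a) (qv j b) = i ≡ j × I i ≡ true × suc a ≡ b × b ≤ t ∸ 4
  ExpEdB (old a) (pv i b) = (a ≡ x⁻ i × b ≡ 0) ⊎ (a ≡ x⁺ i × b ≡ 2 * t ∸ 6)
  ExpEdB (pv i a) (qv j b) =
    i ≡ j × I i ≡ true × ((a ≡ t ∸ 4 × b ≡ 0) ⊎ (a ≡ t ∸ 2 × b ≡ t ∸ 4))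
  ExpEdB _ _ = ⊥

  ExpB : Graph (XV A k)
  ExpB = record { V = ExpS ; E = λ u v → ExpEdB u v ⊎ ExpEdB v u }

record Iso {A A' : Set} (G : Graph A) (H : Graph A') : Set where
  field
    f     : (x : A) → V G x → A'
    g     : (y : A') → V H y → A
    f-irr : ∀ x p p' → f x p ≡ f x p'
    g-irr : ∀ y q q' → g y q ≡ g y q'
    f-V   : ∀ x p → V H (f x p)
    g-V   : ∀ y q → V G (g y q)
    gf    : ∀ x p → g (f x p) (f-V x p) ≡ x
    fg    : ∀ y q → f (g y q) (g-V y q) ≡ y
    f-E   : ∀ x y p q → E G x y ⇔ E H (f x p) (f y q)
open Iso public

IsCanonical : ℕ → {A : Set} → Graph A → Graph A → Set
IsCanonical t T B = SubGraph B T × ∃[ m ] Σ (Expansion t (Tm t m) (Bm t m)) λ D →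
  Σ (Iso T (ExpT t D)) λ φ →
      (∀ x p → V B x ⇔ V (ExpB t D) (f φ x p))
    × (∀ x y p q → E B x y ⇔ E (ExpB t D) (f φ x p) (f φ y q))

{-# OPTIONS --safe #-}
module Submission where

-- Contracting every gadget of the expansion (the new paths P_i and Q_i) onto its vertex x_i maps T
-- onto the territory T_m, each edge going to an edge or collapsing.  A vertex (j , a) of T_m lies
-- above position a·(t−3)^(m−j) of the outer cycle B_m, which has length N = t(t−3)^m, and each step
-- of a walk of length L moves this position by at most t^L (mod N); so every vertex within
-- distance < d of u lies above an arc of B_m of length 2(d−1)t^(d−1).  Above each vertex of B_m the
-- cycle B contains a subpath with fewer than 3t vertices (a single vertex, or some R_i), consecutive
-- ones being adjacent, so the subpaths above the arc form a path in B of length less than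
-- (2(d−1)t^(d−1) + 1)·3t ≤ t^(2d+3t), and the isomorphism of the canonical territory carries it into K.

open import Data.Nat
open import Data.Nat.Properties
open import Data.Nat.DivMod
open import Data.Nat.Tactic.RingSolver using (solve-∀)
open import Algebra.Properties.CommutativeSemigroup +-commutativeSemigroup
  using (x∙yz≈y∙xz; x∙yz≈xz∙y) renaming (xy∙z≈xz∙y to +-right-comm)
open import Data.Bool using (Bool; true; false)
open import Data.Empty using (⊥-elim)
open import Data.Fin using (Fin)
open import Data.Fin.Properties using (any?)
open import Data.Product using (∃₂; ∃-syntax; _×_; _,_; proj₁; proj₂)
open import Data.Product.Properties using (≡-dec)
open import Data.Sum using (_⊎_; inj₁; inj₂)
open import Data.Maybe using (just)
open import Data.Maybe.Relation.Binary.Connected using (Connected; just; just-nothing)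
open import Data.List using (List; []; _∷_; _++_; length; applyUpTo; concatMap; last; head)
open import Data.List.Properties using (length-++; length-applyUpTo)
open import Data.List.Membership.Propositional using (_∈_)
open import Data.List.Membership.Propositional.Properties using (∈-concatMap⁺; ∈-concatMap⁻)
open import Data.List.Relation.Unary.Any using (Any; here; there) renaming (map to mapAny)
import Data.List.Relation.Unary.Any.Properties as Anyₚ
open import Data.List.Relation.Unary.All using (All; []; _∷_; lookupWith)
import Data.List.Relation.Unary.All.Properties as Allₚ
open import Data.List.Relation.Unary.AllPairs using ([]; _∷_)
open import Data.List.Relation.Unary.Unique.Propositional using (Unique)
import Data.List.Relation.Unary.Unique.Propositional.Properties as Uniqueₚ
open import Data.List.Relation.Unary.Linked as Linked using (Linked; []; [-]; _∷_)
import Data.List.Relation.Unary.Linked.Properties as Linkedₚ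
open import Function using (_∘_)
open import Function.Bundles using (_⇔_; Equivalence)
open import Relation.Binary.PropositionalEquality
open import Relation.Nullary using (¬_; yes; no; Dec)
open import Defs

-- Congruences and arcs modulo N

infix 4 _≡_modulo_

_≡_modulo_ : ℕ → ℕ → ℕ → Set
x ≡ y modulo N = ∃₂ λ k l → x + k * N ≡ y + l * N

module _ {N : ℕ} where

  mod-reflexive : ∀ {x y} → x ≡ y → x ≡ y modulo N
  mod-reflexive x≡y = 0 , 0 , cong (_+ 0) x≡y

  mod-sym : ∀ {x y} → x ≡ y modulo N → y ≡ x modulo N
  mod-sym (k , l , eq) = l , k , sym eq

  mod-trans : ∀ {x y z} → x ≡ y modulo N → y ≡ z modulo N → x ≡ z modulo N
  mod-trans {x} {y} {z} (k , l , eq₁) (k' , l' , eq₂) = k + k' , l' + l , (begin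
    x + (k + k') * N       ≡⟨ split x k k' N ⟩
    (x + k * N) + k' * N   ≡⟨ cong (_+ k' * N) eq₁ ⟩
    (y + l * N) + k' * N   ≡⟨ +-right-comm y (l * N) (k' * N) ⟩
    (y + k' * N) + l * N   ≡⟨ cong (_+ l * N) eq₂ ⟩
    (z + l' * N) + l * N   ≡⟨ sym (split z l' l N) ⟩
    z + (l' + l) * N       ∎)
    where
    open ≡-Reasoning
    split : ∀ x k k' N → x + (k + k') * N ≡ (x + k * N) + k' * N
    split = solve-∀

  mod-+ʳ : ∀ {x y} a → x ≡ y modulo N → x + a ≡ y + a modulo N
  mod-+ʳ {x} {y} a (k , l , eq) = k , l , (begin
    x + a + k * N  ≡⟨ +-right-comm x a (k * N) ⟩
    x + k * N + a  ≡⟨ cong (_+ a) eq ⟩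
    y + l * N + a  ≡⟨ +-right-comm y (l * N) a ⟩
    y + a + l * N  ∎)
    where open ≡-Reasoning

  mod-cancelʳ : ∀ {x y} a → x + a ≡ y + a modulo N → x ≡ y modulo N
  mod-cancelʳ {x} {y} a (k , l , eq) = k , l , +-cancelʳ-≡ a _ _ (begin
    x + k * N + a  ≡⟨ +-right-comm x (k * N) a ⟩
    x + a + k * N  ≡⟨ eq ⟩
    y + a + l * N  ≡⟨ +-right-comm y a (l * N) ⟩
    y + l * N + a  ∎)
    where open ≡-Reasoning

  mod-+N : ∀ x → x + N ≡ x modulo N
  mod-+N x = 0 , 1 , +-assoc x N 0

module _ {N : ℕ} .{{_ : NonZero N}} where

  mod⇒%≡ : ∀ {x y} → x ≡ y modulo N → x % N ≡ y % N
  mod⇒%≡ {x} {y} (k , l , eq) = begin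
    x % N            ≡⟨ sym ([m+kn]%n≡m%n x k N) ⟩
    (x + k * N) % N  ≡⟨ cong (_% N) eq ⟩
    (y + l * N) % N  ≡⟨ [m+kn]%n≡m%n y l N ⟩
    y % N            ∎
    where open ≡-Reasoning

  %≡⇒mod : ∀ {x y} → x % N ≡ y % N → x ≡ y modulo N
  %≡⇒mod {x} {y} eq = y / N , x / N , (begin
    x + y / N * N                    ≡⟨ cong (_+ y / N * N) (m≡m%n+[m/n]*n x N) ⟩
    x % N + x / N * N + y / N * N    ≡⟨ cong (λ r → r + x / N * N + y / N * N) eq ⟩
    y % N + x / N * N + y / N * N    ≡⟨ +-right-comm (y % N) _ _ ⟩
    y % N + y / N * N + x / N * N    ≡⟨ cong (_+ x / N * N) (sym (m≡m%n+[m/n]*n y N)) ⟩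
    y + x / N * N                    ∎)
    where open ≡-Reasoning

mod-<-injective : ∀ {N i j} → i < N → j < N → i ≡ j modulo N → i ≡ j
mod-<-injective {N} {i} {j} i<N j<N (k , l , eq) = go k l eq
  where
  N≤ : ∀ x k → N ≤ x + (N + k * N)
  N≤ x k = ≤-trans (m≤m+n N (k * N)) (m≤n+m _ x)
  below : ∀ {x} → x < N → ∀ y k → x + 0 ≢ y + (N + k * N)
  below {x} x<N y k eq = <⇒≱ x<N (≤-trans (N≤ y k) (≤-reflexive (trans (sym eq) (+-identityʳ x))))
  go : ∀ k l → i + k * N ≡ j + l * N → i ≡ j
  go zero    zero    eq = +-cancelʳ-≡ 0 i j eq
  go zero    (suc l) eq = ⊥-elim (below i<N j l eq)
  go (suc k) zero    eq = ⊥-elim (below j<N i k (sym eq))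
  go (suc k) (suc l) eq = go k l (+-cancelˡ-≡ N _ _ (begin
    N + (i + k * N)  ≡⟨ x∙yz≈y∙xz N i (k * N) ⟩
    i + (N + k * N)  ≡⟨ eq ⟩
    j + (N + l * N)  ≡⟨ x∙yz≈y∙xz j N (l * N) ⟩
    N + (j + l * N)  ∎))
    where open ≡-Reasoning

-- b ≡ c + ahead − behind (mod N), the signed displacement being split into two naturals.
record Near (N D c b : ℕ) : Set where
  constructor near
  field
    ahead behind : ℕ
    within : ahead + behind ≤ D
    balance : b + behind ≡ c + ahead modulo N

module _ {N : ℕ} where

  Near-mono : ∀ {D D' c b} → D ≤ D' → Near N D c b → Near N D' c b
  Near-mono D≤D' (near ahead behind within balance) = near ahead behind (≤-trans within D≤D') balance

  Near-forward : ∀ {D c c' b} s → c + s ≡ c' modulo N → Near N D c' b → Near N (s + D) c b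
  Near-forward {D} {c} s shift (near ahead behind within balance) =
    near (s + ahead) behind (subst (_≤ s + D) (sym (+-assoc s ahead behind)) (+-monoʳ-≤ s within))
      (mod-trans balance (mod-trans (mod-sym (mod-+ʳ ahead shift)) (mod-reflexive (+-assoc c s ahead))))

  Near-backward : ∀ {D c c' b} s → c ≡ c' + s modulo N → Near N D c' b → Near N (s + D) c b
  Near-backward {D} {c} {c'} {b} s shift (near ahead behind within balance) =
    near ahead (s + behind) (subst (_≤ s + D) (x∙yz≈y∙xz s ahead behind) (+-monoʳ-≤ s within))
      (mod-trans (mod-reflexive (x∙yz≈xz∙y b s behind))
        (mod-trans (mod-+ʳ s balance)
          (mod-trans (mod-reflexive (+-right-comm c' ahead s)) (mod-+ʳ ahead (mod-sym shift)))))

  -- c + (D * N ∸ D) is c − D modulo N, written without truncated subtraction.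
  Near⇒arc : ∀ {D c b} .{{_ : NonZero N}} → b < N → Near N D c b
    → ∃[ i ] (i ≤ D + D × (c + (D * N ∸ D) + i) % N ≡ b)
  Near⇒arc {D} {c} {b} b<N (near ahead behind within balance) =
    i , +-mono-≤ (m∸n≤m D behind) ahead≤D ,
    (begin
      (c + (D * N ∸ D) + i) % N ≡⟨ mod⇒%≡ (mod-cancelʳ behind congruent) ⟩
      b % N                     ≡⟨ m<n⇒m%n≡m b<N ⟩
      b                         ∎)
    where
    open ≡-Reasoning
    i : ℕ
    i = (D ∸ behind) + ahead
    ahead≤D : ahead ≤ D
    ahead≤D = ≤-trans (m≤m+n ahead behind) within
    behind≤D : behind ≤ D
    behind≤D = ≤-trans (m≤n+m behind ahead) within
    rearrange : ∀ c X Y a b → c + X + (Y + a) + b ≡ c + a + (X + (Y + b))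
    rearrange = solve-∀
    unfold : c + (D * N ∸ D) + i + behind ≡ c + ahead + D * N
    unfold = begin
      c + (D * N ∸ D) + i + behind
        ≡⟨ rearrange c (D * N ∸ D) (D ∸ behind) ahead behind ⟩
      c + ahead + ((D * N ∸ D) + ((D ∸ behind) + behind))
        ≡⟨ cong (λ x → c + ahead + ((D * N ∸ D) + x)) (m∸n+n≡m behind≤D) ⟩
      c + ahead + ((D * N ∸ D) + D)
        ≡⟨ cong (c + ahead +_) (m∸n+n≡m (m≤m*n D N)) ⟩
      c + ahead + D * N
        ∎
    congruent : c + (D * N ∸ D) + i + behind ≡ b + behind modulo N
    congruent = mod-trans (mod-reflexive unfold) (mod-trans (0 , D , +-identityʳ _) (mod-sym balance))

module CyclicOrder (N : ℕ) .{{_ : NonZero N}} where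

  next : ℕ → ℕ
  next p = suc p % N

  next<N : ∀ p → next p < N
  next<N p = m%n<n (suc p) N

  next-% : ∀ x → next (x % N) ≡ suc x % N
  next-% x = begin
    (1 + x % N) % N             ≡⟨ %-distribˡ-+ 1 (x % N) N ⟩
    (1 % N + x % N % N) % N     ≡⟨ cong (λ y → (1 % N + y) % N) (m%n%n≡m%n x N) ⟩
    (1 % N + x % N) % N         ≡⟨ sym (%-distribˡ-+ 1 x N) ⟩
    (1 + x) % N                 ∎
    where open ≡-Reasoning

  next-injective : ∀ {p q} → p < N → q < N → next p ≡ next q → p ≡ q
  next-injective {p} {q} p<N q<N eq =
    mod-<-injective p<N q<N (mod-cancelʳ 1 (subst₂ (λ x y → x ≡ y modulo N) (+-comm 1 p) (+-comm 1 q) (%≡⇒mod eq)))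

  CycAdj-next : ∀ {p} → p < N → CycAdj N p (next p)
  CycAdj-next {p} p<N with suc p <? N
  ... | yes 1+p<N = inj₁ (sym (m<n⇒m%n≡m 1+p<N))
  ... | no 1+p≮N  = inj₂ (inj₂ (inj₁ (1+p≡N , trans (cong (_% N) 1+p≡N) (n%n≡0 N))))
    where
    1+p≡N : suc p ≡ N
    1+p≡N = ≤-antisym p<N (≮⇒≥ 1+p≮N)

  CycAdj⇒next : ∀ {p q} → p < N → q < N → CycAdj N p q → q ≡ next p ⊎ next q ≡ p
  CycAdj⇒next p<N q<N (inj₁ refl)                  = inj₁ (sym (m<n⇒m%n≡m q<N))
  CycAdj⇒next p<N q<N (inj₂ (inj₁ refl))           = inj₂ (m<n⇒m%n≡m p<N)
  CycAdj⇒next p<N q<N (inj₂ (inj₂ (inj₁ (1+p≡N , refl)))) = inj₁ (sym (trans (cong (_% N) 1+p≡N) (n%n≡0 N)))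
  CycAdj⇒next p<N q<N (inj₂ (inj₂ (inj₂ (1+q≡N , refl)))) = inj₂ (trans (cong (_% N) 1+q≡N) (n%n≡0 N))

  arc : ℕ → ℕ → List ℕ
  arc s ℓ = applyUpTo (λ i → (s + i) % N) (suc ℓ)

  arc-All : ∀ {P : ℕ → Set} s ℓ → (∀ {p} → p < N → P p) → All P (arc s ℓ)
  arc-All s ℓ P<N = Allₚ.applyUpTo⁺₂ _ (suc ℓ) (λ i → P<N (m%n<n (s + i) N))

  arc-Linked : ∀ {R : ℕ → ℕ → Set} s ℓ → (∀ {p} → p < N → R p (next p)) → Linked R (arc s ℓ)
  arc-Linked {R} s ℓ R-next = Linkedₚ.applyUpTo⁺₂ _ (suc ℓ) step
    where
    step : ∀ i → R ((s + i) % N) ((s + suc i) % N)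
    step i = subst (R ((s + i) % N)) (trans (next-% (s + i)) (cong (_% N) (sym (+-suc s i))))
               (R-next (m%n<n (s + i) N))

  arc-Unique : ∀ s {ℓ} → ℓ < N → Unique (arc s ℓ)
  arc-Unique s {ℓ} ℓ<N = Uniqueₚ.applyUpTo⁺₁ _ (suc ℓ) distinct
    where
    distinct : ∀ {i j} → i < j → j < suc ℓ → (s + i) % N ≢ (s + j) % N
    distinct {i} {j} i<j j<1+ℓ eq = <⇒≢ i<j
      (mod-<-injective (<-trans i<j j<N) j<N
        (mod-cancelʳ s (subst₂ (λ x y → x ≡ y modulo N) (+-comm s i) (+-comm s j) (%≡⇒mod eq))))
      where
      j<N : j < N
      j<N = <-≤-trans j<1+ℓ ℓ<N

  record ArcAround (D c : ℕ) : Set where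
    field
      origin len : ℕ
      len<N : len < N
      len≤ : len ≤ D + D
      covers : ∀ {b} → b < N → Near N D c b → b ∈ arc origin len

  arcAround : ∀ D c → ArcAround D c
  arcAround D c with suc (D + D) ≤? N
  ... | yes 2D<N = record
    { origin = c + (D * N ∸ D) ; len = D + D ; len<N = 2D<N ; len≤ = ≤-refl
    ; covers = λ b<N close → let i , i≤ , eq = Near⇒arc b<N close in
                 Anyₚ.applyUpTo⁺ (λ i → (c + (D * N ∸ D) + i) % N) (sym eq) (s≤s i≤)
    }
  ... | no 2D≮N = record
    { origin = 0 ; len = N ∸ 1 ; len<N = N∸1<N ; len≤ = <⇒≤ (≤-trans (≤-reflexive N∸1+1) (≮⇒≥ 2D≮N))
    ; covers = λ {b} b<N _ → Anyₚ.applyUpTo⁺ (λ i → (0 + i) % N) (sym (m<n⇒m%n≡m b<N)) (subst (b <_) (sym N∸1+1) b<N)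
    }
    where
    N∸1+1 : suc (N ∸ 1) ≡ N
    N∸1+1 = suc-pred N
    N∸1<N : N ∸ 1 < N
    N∸1<N = subst (N ∸ 1 <_) N∸1+1 ≤-refl

-- Paths given by enumerations, and their concatenation

last-applyUpTo : ∀ {X : Set} (f : ℕ → X) n → last (applyUpTo f (suc n)) ≡ just (f n)
last-applyUpTo f zero    = refl
last-applyUpTo f (suc n) = last-applyUpTo (λ i → f (suc i)) n

record IsPathFn {X : Set} (G : Graph X) (n : ℕ) (h : ℕ → X) : Set where
  field
    vertex    : ∀ {s} → s ≤ n → V G (h s)
    injective : ∀ {s s'} → s ≤ n → s' ≤ n → h s ≡ h s' → s ≡ s'
    edge      : ∀ {s} → s < n → E G (h s) (h (suc s))

module _ {X : Set} {G : Graph X} where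

  IsPathFn⇒IsPath : ∀ {n h} → IsPathFn G n h → IsPath G (applyUpTo h (suc n))
  IsPathFn⇒IsPath {n} {h} P =
      Allₚ.applyUpTo⁺₁ h (suc n) (λ s<1+n → vertex (≤-pred s<1+n))
    , Uniqueₚ.applyUpTo⁺₁ h (suc n)
        (λ s<s' s'<1+n eq → <⇒≢ s<s' (injective (≤-pred (<-trans s<s' s'<1+n)) (≤-pred s'<1+n) eq))
    , Linkedₚ.applyUpTo⁺₁ h (suc n) (λ 1+s<1+n → edge (≤-pred 1+s<1+n))
    where open IsPathFn P

  IsPathFn-reverse : (∀ {x y} → E G x y → E G y x) → ∀ {n h} → IsPathFn G n h → IsPathFn G n (λ s → h (n ∸ s))
  IsPathFn-reverse E-sym {n} {h} P = record
    { vertex    = λ {s} _ → vertex (m∸n≤m n s)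
    ; injective = λ {s} {s'} s≤n s'≤n eq → ∸-cancelˡ-≡ s≤n s'≤n (injective (m∸n≤m n s) (m∸n≤m n s') eq)
    ; edge      = λ {s} s<n → subst (λ i → E G (h i) (h (n ∸ suc s))) (sym (+-∸-assoc 1 s<n))
                    (E-sym (edge (subst (_≤ n) (+-∸-assoc 1 s<n) (m∸n≤m n s))))
    }
    where open IsPathFn P

module Chain {X L : Set} (G : Graph X) (label : X → L) (seg : L → ℕ → X) (len : L → ℕ) where

  segment : L → List X
  segment p = applyUpTo (seg p) (suc (len p))

  chain : List L → List X
  chain = concatMap segment

  IsSegment : L → Set
  IsSegment p = IsPathFn G (len p) (seg p) × (∀ {s} → s ≤ len p → label (seg p s) ≡ p)

  Joined : L → L → Set
  Joined p q = E G (seg p (len p)) (seg q 0)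

  segment-label : ∀ {p v} → IsSegment p → v ∈ segment p → label v ≡ p
  segment-label {p} S v∈ with Anyₚ.applyUpTo⁻ (seg p) v∈
  ... | s , s<1+len , refl = proj₂ S (≤-pred s<1+len)

  chain-label : ∀ {ps v} → All IsSegment ps → v ∈ chain ps → Any (label v ≡_) ps
  chain-label {ps} {v} Ss v∈ = go Ss (∈-concatMap⁻ segment {xs = ps} v∈)
    where
    go : ∀ {qs} → All IsSegment qs → Any (λ q → v ∈ segment q) qs → Any (label v ≡_) qs
    go (S ∷ _)  (here v∈q) = here (segment-label S v∈q)
    go (_ ∷ Ss) (there v∈) = there (go Ss v∈)

  chain-IsPath : ∀ ps → All IsSegment ps → Unique ps → Linked Joined ps → IsPath G (chain ps)
  chain-IsPath []       _        _        _      = [] , [] , []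
  chain-IsPath (p ∷ ps) (S ∷ Ss) (p∉ ∷ u) joins =
    let segV , segU , segL    = IsPathFn⇒IsPath (proj₁ S)
        restV , restU , restL = chain-IsPath ps Ss u (Linked.tail joins)
    in  Allₚ.++⁺ segV restV
      , Uniqueₚ.++⁺ segU restU disjoint
      , Linkedₚ.++⁺ segL (subst (λ x → Connected (E G) x (head (chain ps))) (sym (last-applyUpTo (seg p) (len p)))
                                (joint ps joins))
                    restL
    where
    disjoint : ∀ {v} → ¬ (v ∈ segment p × v ∈ chain ps)
    disjoint (v∈p , v∈ps) =
      lookupWith (λ p≢q v≡q → p≢q (trans (sym (segment-label S v∈p)) v≡q)) p∉ (chain-label Ss v∈ps)
    joint : ∀ qs → Linked Joined (p ∷ qs) → Connected (E G) (just (seg p (len p))) (head (chain qs))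
    joint []      _          = just-nothing
    joint (q ∷ _) (j ∷ _)    = just j

  chain-∈ : ∀ {p ps s} → p ∈ ps → s ≤ len p → seg p s ∈ chain ps
  chain-∈ {p} {ps} p∈ps s≤len =
    ∈-concatMap⁺ segment {xs = ps} (mapAny (λ { refl → Anyₚ.applyUpTo⁺ (seg p) refl (s≤s s≤len) }) p∈ps)

  length-chain : ∀ {c} ps → All (λ p → len p < c) ps → length (chain ps) ≤ length ps * c
  length-chain []       []             = z≤n
  length-chain (p ∷ ps) (len<c ∷ lens) = begin
    length (segment p ++ chain ps)          ≡⟨ length-++ (segment p) ⟩
    length (segment p) + length (chain ps)  ≤⟨ +-mono-≤ (≤-trans (≤-reflexive (length-applyUpTo (seg p) _)) len<c)
                                                         (length-chain ps lens) ⟩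
    _ + length ps * _                       ∎
    where open ≤-Reasoning

module _ {X Y : Set} {P : X → Set} (h : (x : X) → P x → Y) where

  mapWithAll : (xs : List X) → All P xs → List Y
  mapWithAll []       []         = []
  mapWithAll (x ∷ xs) (px ∷ pxs) = h x px ∷ mapWithAll xs pxs

  length-mapWithAll : ∀ xs pxs → length (mapWithAll xs pxs) ≡ length xs
  length-mapWithAll []       []         = refl
  length-mapWithAll (x ∷ xs) (px ∷ pxs) = cong suc (length-mapWithAll xs pxs)

  mapWithAll-All : ∀ {Q : Y → Set} → (∀ x px → Q (h x px)) → ∀ xs pxs → All Q (mapWithAll xs pxs)
  mapWithAll-All Qh []       []         = []
  mapWithAll-All Qh (x ∷ xs) (px ∷ pxs) = Qh x px ∷ mapWithAll-All Qh xs pxs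

  mapWithAll-Linked : ∀ {R : X → X → Set} {S : Y → Y → Set} → (∀ {x y} px py → R x y → S (h x px) (h y py))
    → ∀ xs pxs → Linked R xs → Linked S (mapWithAll xs pxs)
  mapWithAll-Linked Sh []           []               []        = []
  mapWithAll-Linked Sh (x ∷ [])     (px ∷ [])        [-]       = [-]
  mapWithAll-Linked Sh (x ∷ y ∷ xs) (px ∷ py ∷ pxs) (Rxy ∷ l) =
    Sh px py Rxy ∷ mapWithAll-Linked Sh (y ∷ xs) (py ∷ pxs) l

  mapWithAll-Unique : (∀ {x y} px py → h x px ≡ h y py → x ≡ y) → ∀ xs pxs → Unique xs → Unique (mapWithAll xs pxs)
  mapWithAll-Unique h-inj []       []         []        = []
  mapWithAll-Unique h-inj (x ∷ xs) (px ∷ pxs) (x∉ ∷ u) = fresh xs pxs x∉ ∷ mapWithAll-Unique h-inj xs pxs u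
    where
    fresh : ∀ ys pys → All (λ y → ¬ x ≡ y) ys → All (λ z → ¬ h x px ≡ z) (mapWithAll ys pys)
    fresh []       []         []          = []
    fresh (y ∷ ys) (py ∷ pys) (x≢y ∷ x∉) = (λ eq → x≢y (h-inj px py eq)) ∷ fresh ys pys x∉

  module _ (h-irrelevant : ∀ x px px' → h x px ≡ h x px') where

    mapWithAll-∈ : ∀ {x} px xs pxs → x ∈ xs → h x px ∈ mapWithAll xs pxs
    mapWithAll-∈ px (y ∷ xs) (py ∷ pxs) (here refl) = here (h-irrelevant _ px py)
    mapWithAll-∈ px (y ∷ xs) (py ∷ pxs) (there x∈) = there (mapWithAll-∈ px xs pxs x∈)

    lastOf-mapWithAll : ∀ x px xs pxs plast → lastOf (h x px) (mapWithAll xs pxs) ≡ h (lastOf x xs) plast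
    lastOf-mapWithAll x px []       []         plast = h-irrelevant x px plast
    lastOf-mapWithAll x px (y ∷ xs) (py ∷ pxs) plast = lastOf-mapWithAll y py xs pxs plast

-- The territory (T_m , B_m)

CycAdj-sym : ∀ {n a b} → CycAdj n a b → CycAdj n b a
CycAdj-sym (inj₁ e)               = inj₂ (inj₁ e)
CycAdj-sym (inj₂ (inj₁ e))        = inj₁ e
CycAdj-sym (inj₂ (inj₂ (inj₁ e))) = inj₂ (inj₂ (inj₂ e))
CycAdj-sym (inj₂ (inj₂ (inj₂ e))) = inj₂ (inj₂ (inj₁ e))

module _ {t m : ℕ} where

  Tm-sym : ∀ {v v'} → E (Tm t m) v v' → E (Tm t m) v' v
  Tm-sym (tv , tv' , inj₁ (refl , adj))  = tv' , tv , inj₁ (refl , CycAdj-sym adj)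
  Tm-sym (tv , tv' , inj₂ (inj₁ child))  = tv' , tv , inj₂ (inj₂ child)
  Tm-sym (tv , tv' , inj₂ (inj₂ parent)) = tv' , tv , inj₂ (inj₁ parent)

  Bm⊆Tm : ∀ {v v'} → E (Bm t m) v v' → E (Tm t m) v v'
  Bm⊆Tm ((refl , a<) , (refl , b<) , refl , adj) = (≤-refl , a<) , (≤-refl , b<) , inj₁ (refl , adj)

module OuterCycle (t m : ℕ) .{{_ : NonZero t}} where

  w : ℕ
  w = t ∸ 3

  N : ℕ
  N = Len t m

  -- B_{j+1} subdivides B_j (t−3)-fold, so the descendants of (j , a) on B_m start at this position.
  centre : ℕ × ℕ → ℕ
  centre (j , a) = a * w ^ (m ∸ j)

  Len-scaled : ∀ {j} → j ≤ m → Len t j * w ^ (m ∸ j) ≡ N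
  Len-scaled {j} j≤m = begin
    t * w ^ j * w ^ (m ∸ j)    ≡⟨ *-assoc t _ _ ⟩
    t * (w ^ j * w ^ (m ∸ j))  ≡⟨ cong (t *_) (sym (^-distribˡ-+-* w j (m ∸ j))) ⟩
    t * w ^ (j + (m ∸ j))      ≡⟨ cong (λ n → t * w ^ n) (m+[n∸m]≡n j≤m) ⟩
    t * w ^ m                  ∎
    where open ≡-Reasoning

  centre-child : ∀ {j} a → suc j ≤ m → centre (suc j , w * a) ≡ centre (j , a)
  centre-child {j} a j<m = begin
    w * a * w ^ (m ∸ suc j)    ≡⟨ cong (_* w ^ (m ∸ suc j)) (*-comm w a) ⟩
    a * w * w ^ (m ∸ suc j)    ≡⟨ *-assoc a w _ ⟩
    a * w ^ suc (m ∸ suc j)    ≡⟨ cong (λ n → a * w ^ n) (sym (+-∸-assoc 1 j<m)) ⟩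
    a * w ^ (m ∸ j)            ∎
    where open ≡-Reasoning

  centre-wrap : ∀ {j a} → j ≤ m → suc a ≡ Len t j → centre (j , a) + w ^ (m ∸ j) ≡ N
  centre-wrap {j} {a} j≤m 1+a≡Len =
    trans (+-comm (a * w ^ (m ∸ j)) _) (trans (cong (_* w ^ (m ∸ j)) 1+a≡Len) (Len-scaled j≤m))

  centre-CycAdj : ∀ {j a b} → j ≤ m → CycAdj (Len t j) a b
    → centre (j , a) + w ^ (m ∸ j) ≡ centre (j , b) modulo N
    ⊎ centre (j , a) ≡ centre (j , b) + w ^ (m ∸ j) modulo N
  centre-CycAdj {j} {a} j≤m (inj₁ refl)        = inj₁ (mod-reflexive (+-comm (a * w ^ (m ∸ j)) _))
  centre-CycAdj {j} {b = b} j≤m (inj₂ (inj₁ refl)) = inj₂ (mod-reflexive (+-comm (w ^ (m ∸ j)) (b * _)))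
  centre-CycAdj j≤m (inj₂ (inj₂ (inj₁ (1+a≡Len , refl)))) =
    inj₁ (mod-trans (mod-reflexive (centre-wrap j≤m 1+a≡Len)) (mod-+N 0))
  centre-CycAdj j≤m (inj₂ (inj₂ (inj₂ (1+b≡Len , refl)))) =
    inj₂ (mod-sym (mod-trans (mod-reflexive (centre-wrap j≤m 1+b≡Len)) (mod-+N 0)))

  StepOrStay : ℕ × ℕ → ℕ × ℕ → Set
  StepOrStay v v' = E (Tm t m) v v' ⊎ v ≡ v'

  drift : ℕ → ℕ
  drift L = L * t ^ L

  drift-mono : ∀ {L L'} → L ≤ L' → drift L ≤ drift L'
  drift-mono L≤L' = *-mono-≤ L≤L' (^-monoʳ-≤ t L≤L')

  drift-suc : ∀ {s} L → s ≤ t ^ L → s + drift L ≤ drift (suc L)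
  drift-suc L s≤ = +-mono-≤ (≤-trans s≤ (^-monoʳ-≤ t (n≤1+n L))) (*-monoʳ-≤ L (^-monoʳ-≤ t (n≤1+n L)))

  scale≤ : ∀ {j L} → m ∸ j ≤ L → w ^ (m ∸ j) ≤ t ^ L
  scale≤ {j} m∸j≤L = ≤-trans (^-monoˡ-≤ (m ∸ j) (m∸n≤m t 3)) (^-monoʳ-≤ t m∸j≤L)

  record Reach (v : ℕ × ℕ) (b L : ℕ) : Set where
    constructor reach
    field
      depth : m ∸ proj₁ v ≤ L
      nearby : Near N (drift L) (centre v) b

  -- A step at level j moves the centre by ±(t−3)^(m−j) (mod N) or not at all, and m − j ≤ L.
  reach-step : ∀ {v v' b L} → StepOrStay v v' → Reach v' b L → Reach v b (suc L)
  reach-step {L = L} (inj₂ refl) (reach depth nr) =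
    reach (m≤n⇒m≤1+n depth) (Near-mono (drift-mono (n≤1+n L)) nr)
  reach-step {j , _} {L = L} (inj₁ ((j≤m , _) , _ , inj₁ (refl , adj))) (reach depth nr)
    with centre-CycAdj j≤m adj
  ... | inj₁ fwd = reach (m≤n⇒m≤1+n depth) (Near-mono (drift-suc L (scale≤ {j} depth)) (Near-forward _ fwd nr))
  ... | inj₂ bwd = reach (m≤n⇒m≤1+n depth) (Near-mono (drift-suc L (scale≤ {j} depth)) (Near-backward _ bwd nr))
  reach-step {j , a} {b = b} {L} (inj₁ (_ , (j<m , _) , inj₂ (inj₁ (refl , refl)))) (reach depth nr) =
    reach (subst (_≤ suc L) (sym (+-∸-assoc 1 j<m)) (s≤s depth))
          (Near-mono (drift-mono (n≤1+n L)) (subst (λ c → Near N (drift L) c b) (centre-child a j<m) nr))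
  reach-step {_ , a} {j , a'} {b} {L} (inj₁ ((j<m , _) , _ , inj₂ (inj₂ (refl , refl)))) (reach depth nr) =
    reach (m≤n⇒m≤1+n (≤-trans (∸-monoʳ-≤ m (n≤1+n j)) depth))
          (Near-mono (drift-mono (n≤1+n L)) (subst (λ c → Near N (drift L) c b) (sym (centre-child a' j<m)) nr))

  reach-walk : ∀ v vs {b} → Linked StepOrStay (v ∷ vs) → lastOf v vs ≡ (m , b) → Reach v b (length vs)
  reach-walk v [] {b} _ refl = reach (≤-reflexive (n∸n≡0 m)) (near 0 0 z≤n (mod-reflexive (cong (_+ 0) b≡centre)))
    where
    b≡centre : b ≡ b * w ^ (m ∸ m)
    b≡centre = sym (trans (cong (λ n → b * w ^ n) (n∸n≡0 m)) (*-identityʳ b))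
  reach-walk v (v' ∷ vs) (step ∷ walk) last≡ = reach-step step (reach-walk v' vs walk last≡)

-- Expansions of (T_m , B_m)

module Fibres (r m : ℕ) (D : Expansion (5 + r) (Tm (5 + r) m) (Bm (5 + r) m)) where

  t : ℕ
  t = 5 + r

  open OuterCycle t m public
  open Expansion D

  instance
    N-nonZero : NonZero N
    N-nonZero = m*n≢0 t (w ^ m) {{_}} {{m^n≢0 w m}}

  open CyclicOrder N public

  Vertex : Set
  Vertex = XV (ℕ × ℕ) k

  T B : Graph Vertex
  T = ExpT t D
  B = ExpB t D

  π : Vertex → ℕ × ℕ
  π (old v)  = v
  π (pv i _) = x i
  π (qv i _) = x i

  position : Vertex → ℕ
  position v = proj₂ (π v)

  StepOrStay-sym : ∀ {v v'} → StepOrStay v v' → StepOrStay v' v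
  StepOrStay-sym (inj₁ e)    = inj₁ (Tm-sym e)
  StepOrStay-sym (inj₂ refl) = inj₂ refl

  π-ExpEd : ∀ v v' → ExpEd t D v v' → StepOrStay (π v) (π v')
  π-ExpEd (old _)  (old _)  e                         = inj₁ e
  π-ExpEd (pv _ _) (pv _ _) (refl , _)                = inj₂ refl
  π-ExpEd (qv _ _) (qv _ _) (refl , _)                = inj₂ refl
  π-ExpEd (pv _ _) (qv _ _) (refl , _)                = inj₂ refl
  π-ExpEd (old _)  (pv i _) (inj₁ (refl , _))         = inj₁ (Tm-sym (Bm⊆Tm (x⁻-adj i)))
  π-ExpEd (old _)  (pv i _) (inj₂ (inj₁ (refl , _)))  = inj₂ refl
  π-ExpEd (old _)  (pv i _) (inj₂ (inj₂ (refl , _)))  = inj₁ (Tm-sym (Bm⊆Tm (x⁺-adj i)))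

  π-E : ∀ {v v'} → E T v v' → StepOrStay (π v) (π v')
  π-E {v} {v'} (inj₁ e) = π-ExpEd v v' e
  π-E {v} {v'} (inj₂ e) = StepOrStay-sym (π-ExpEd v' v e)

  B⊆T : ∀ {v} → V B v → V T v
  B⊆T {old _}  ((refl , a<) , _) = ≤-refl , a<
  B⊆T {pv _ _} (a≤ , _)          = a≤
  B⊆T {qv _ _} q                 = q

  B-sym : ∀ {v v'} → E B v v' → E B v' v
  B-sym (inj₁ e) = inj₂ e
  B-sym (inj₂ e) = inj₁ e

  onOuter : ∀ {v} → V (Bm t m) v → v ≡ (m , proj₂ v) × proj₂ v < N
  onOuter (refl , p<N) = refl , p<N

  B-onOuter : ∀ {v} → V B v → π v ≡ (m , position v) × position v < N
  B-onOuter {old _}  (vB , _) = onOuter vB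
  B-onOuter {pv i _} _        = onOuter (x-in i)
  B-onOuter {qv i _} _        = onOuter (x-in i)

  _≟²_ : (u v : ℕ × ℕ) → Dec (u ≡ v)
  _≟²_ = ≡-dec _≟_ _≟_

  find : ∀ p → (∃[ i ] x i ≡ (m , p)) ⊎ (∀ i → x i ≢ (m , p))
  find p with any? (λ i → x i ≟² (m , p))
  ... | yes found = inj₁ found
  ... | no ∄      = inj₂ (λ i eq → ∄ (i , eq))

  Bm-neighbour : ∀ {p y} → p < N → E (Bm t m) (m , p) y
    → y ≡ (m , next p) ⊎ ∃[ q ] (q < N × y ≡ (m , q) × next q ≡ p)
  Bm-neighbour p<N (_ , (refl , q<N) , refl , adj) with CycAdj⇒next p<N q<N adj
  ... | inj₁ refl = inj₁ refl
  ... | inj₂ eq   = inj₂ (_ , q<N , refl , eq)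

  x⁺-next : ∀ {i p} → x i ≡ (m , p) → p < N → x⁻ i ≢ (m , next p) → x⁺ i ≡ (m , next p)
  x⁺-next {i} {p} xi≡ p<N x⁻≢ with neighbour (x⁻-adj i) | neighbour (x⁺-adj i)
    where
    neighbour : ∀ {y} → E (Bm t m) (x i) y → y ≡ (m , next p) ⊎ ∃[ q ] (q < N × y ≡ (m , q) × next q ≡ p)
    neighbour {y} e = Bm-neighbour p<N (subst (λ z → E (Bm t m) z y) xi≡ e)
  ... | inj₁ eq | _       = ⊥-elim (x⁻≢ eq)
  ... | inj₂ _  | inj₁ eq = eq
  ... | inj₂ (q , q<N , x⁻≡ , nq) | inj₂ (q' , q'<N , x⁺≡ , nq') =
    ⊥-elim (x⁻≢x⁺ i (trans x⁻≡ (trans (cong (m ,_) (next-injective q<N q'<N (trans nq (sym nq')))) (sym x⁺≡))))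

  neighbour-previous : ∀ {j p y} → x j ≡ (m , next p) → p < N
    → E (Bm t m) (x j) y → y ≢ (m , next (next p)) → y ≡ (m , p)
  neighbour-previous {y = y} xj≡ p<N e y≢ with Bm-neighbour (next<N _) (subst (λ z → E (Bm t m) z y) xj≡ e)
  ... | inj₁ eq                    = ⊥-elim (y≢ eq)
  ... | inj₂ (q , q<N , refl , nq) = cong (m ,_) (next-injective q<N p<N nq)

  2t∸6≡w+w : 2 * t ∸ 6 ≡ w + w
  2t∸6≡w+w = trans (cong (_∸ 6) (double r)) (m+n∸m≡n 6 (w + w))
    where
    double : ∀ r → 2 * (5 + r) ≡ 6 + (suc (suc r) + suc (suc r))
    double = solve-∀

  P-edge : ∀ {i a} → suc a ≤ w + w → (I i ≡ true → a ≢ w × suc a ≢ w) → E B (pv i a) (pv i (suc a))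
  P-edge {a = a} 1+a≤ avoids-y = inj₁ (refl , refl , subst (suc a ≤_) (sym 2t∸6≡w+w) 1+a≤ , avoids-y)

  -- R_i for i ∈ I: its first w vertices lie on P_i up to v_i⁻, the next w on Q_i, the last w on P_i
  -- from v_i⁺ on (here w = t − 3, y_i = pv i w, v_i⁻ = pv i (w ∸ 1), v_i⁺ = pv i (suc w)).
  detour : Fin k → ℕ → Vertex
  detour i s with s <? w | s <? w + w
  ... | yes _ | _     = pv i s
  ... | no _  | yes _ = qv i (s ∸ w)
  ... | no _  | no _  = pv i (suc (s ∸ w))

  detour-P⁻ : ∀ {i s} → s < w → detour i s ≡ pv i s
  detour-P⁻ {i} {s} s<w with s <? w | s <? w + w
  ... | yes _   | _ = refl
  ... | no s≮w  | _ = ⊥-elim (s≮w s<w)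

  detour-Q : ∀ {i s} → s < w → detour i (w + s) ≡ qv i s
  detour-Q {i} {s} s<w with w + s <? w | w + s <? w + w
  ... | yes w+s<w | _     = ⊥-elim (m+n≮m w s w+s<w)
  ... | no _      | yes _ = cong (qv i) (m+n∸m≡n w s)
  ... | no _      | no ≮  = ⊥-elim (≮ (+-monoʳ-< w s<w))

  detour-P⁺ : ∀ {i} s → detour i (w + w + s) ≡ pv i (suc (w + s))
  detour-P⁺ {i} s with w + w + s <? w | w + w + s <? w + w
  ... | yes < | _     = ⊥-elim (m+n≮m w (w + s) (subst (_< w) (+-assoc w w s) <))
  ... | no _  | yes < = ⊥-elim (m+n≮m (w + w) s <)
  ... | no _  | no _  = cong (λ n → pv i (suc n)) (trans (cong (_∸ w) (+-assoc w w s)) (m+n∸m≡n w (w + s)))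

  data DetourView : ℕ → Set where
    on-P⁻ : ∀ {s} → s < w → DetourView s
    on-Q  : ∀ {s} → s < w → DetourView (w + s)
    on-P⁺ : ∀ s → DetourView (w + w + s)

  detourView : ∀ s → DetourView s
  detourView s with s <? w | s <? w + w
  ... | yes s<w | _        = on-P⁻ s<w
  ... | no s≮w  | yes s<2w = subst DetourView w+[s∸w]≡s
                               (on-Q (+-cancelˡ-< w _ _ (subst (_< w + w) (sym w+[s∸w]≡s) s<2w)))
    where
    w+[s∸w]≡s : w + (s ∸ w) ≡ s
    w+[s∸w]≡s = m+[n∸m]≡n (≮⇒≥ s≮w)
  ... | no _    | no s≮2w  = subst DetourView (m+[n∸m]≡n (≮⇒≥ s≮2w)) (on-P⁺ _)

  detourLen : ℕ
  detourLen = w + w + (w ∸ 1)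

  w+w≡1+w+[w∸1] : w + w ≡ suc (w + (w ∸ 1))
  w+w≡1+w+[w∸1] = +-suc w (w ∸ 1)

  detour-start : ∀ {i} → detour i 0 ≡ pv i 0
  detour-start = detour-P⁻ (s≤s z≤n)

  detour-end : ∀ {i} → detour i detourLen ≡ pv i (w + w)
  detour-end {i} = trans (detour-P⁺ (w ∸ 1)) (cong (pv i) (sym w+w≡1+w+[w∸1]))

  detour-π : ∀ i s → π (detour i s) ≡ x i
  detour-π i s with s <? w | s <? w + w
  ... | yes _ | _     = refl
  ... | no _  | yes _ = refl
  ... | no _  | no _  = refl

  P⁺-bound : ∀ {s} → s ≤ w ∸ 1 → suc (w + s) ≤ w + w
  P⁺-bound s≤ = ≤-trans (s≤s (+-monoʳ-≤ w s≤)) (≤-reflexive (sym w+w≡1+w+[w∸1]))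

  detour-V : ∀ {i s} → I i ≡ true → s ≤ detourLen → V B (detour i s)
  detour-V {i} {s} I≡ s≤ with detourView s
  ... | on-P⁻ s<w  rewrite detour-P⁻ {i} s<w =
    subst (s ≤_) (sym 2t∸6≡w+w) (≤-trans (<⇒≤ s<w) (m≤m+n w w)) , λ _ → <⇒≢ s<w
  ... | on-Q s'<w  rewrite detour-Q {i} s'<w = I≡ , ≤-pred s'<w
  ... | on-P⁺ s'   rewrite detour-P⁺ {i} s' =
    subst (suc (w + s') ≤_) (sym 2t∸6≡w+w) (P⁺-bound (+-cancelˡ-≤ (w + w) _ _ s≤)) , λ _ → >⇒≢ (s≤s (m≤m+n w s'))

  pv-index : ∀ {i j a b} → pv {ℕ × ℕ} {k} i a ≡ pv j b → a ≡ b
  pv-index refl = refl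

  qv-index : ∀ {i j a b} → qv {ℕ × ℕ} {k} i a ≡ qv j b → a ≡ b
  qv-index refl = refl

  P⁻≢P⁺ : ∀ {a b} → a < w → a ≢ suc (w + b)
  P⁻≢P⁺ {a} {b} a<w a≡ = <⇒≱ a<w (subst (w ≤_) (sym a≡) (≤-trans (m≤m+n w b) (n≤1+n _)))

  detour-injective : ∀ {i} s s' → detour i s ≡ detour i s' → s ≡ s'
  detour-injective {i} s s' with detourView s | detourView s'
  ... | on-P⁻ a<w | on-P⁻ b<w rewrite detour-P⁻ {i} a<w | detour-P⁻ {i} b<w = pv-index
  ... | on-P⁻ a<w | on-Q  b<w rewrite detour-P⁻ {i} a<w | detour-Q  {i} b<w = λ ()
  ... | on-P⁻ a<w | on-P⁺ b   rewrite detour-P⁻ {i} a<w | detour-P⁺ {i} b   = ⊥-elim ∘ P⁻≢P⁺ a<w ∘ pv-index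
  ... | on-Q  a<w | on-P⁻ b<w rewrite detour-Q  {i} a<w | detour-P⁻ {i} b<w = λ ()
  ... | on-Q  a<w | on-Q  b<w rewrite detour-Q  {i} a<w | detour-Q  {i} b<w = cong (w +_) ∘ qv-index
  ... | on-Q  a<w | on-P⁺ b   rewrite detour-Q  {i} a<w | detour-P⁺ {i} b   = λ ()
  ... | on-P⁺ a   | on-P⁻ b<w rewrite detour-P⁺ {i} a   | detour-P⁻ {i} b<w = ⊥-elim ∘ P⁻≢P⁺ b<w ∘ sym ∘ pv-index
  ... | on-P⁺ a   | on-Q  b<w rewrite detour-P⁺ {i} a   | detour-Q  {i} b<w = λ ()
  ... | on-P⁺ a   | on-P⁺ b   rewrite detour-P⁺ {i} a   | detour-P⁺ {i} b   =
    cong (w + w +_) ∘ +-cancelˡ-≡ w _ _ ∘ suc-injective ∘ pv-index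

  junction-PQ : ∀ {i} → I i ≡ true → E B (detour i (w ∸ 1)) (detour i w)
  junction-PQ {i} I≡ =
    subst₂ (E B) (sym (detour-P⁻ ≤-refl)) (sym (trans (cong (detour i) (sym (+-identityʳ w))) (detour-Q (s≤s z≤n))))
      (inj₁ (refl , I≡ , inj₁ (refl , refl)))

  junction-QP : ∀ {i} → I i ≡ true → E B (detour i (w + (w ∸ 1))) (detour i (suc (w + (w ∸ 1))))
  junction-QP {i} I≡ =
    subst₂ (E B) (sym (detour-Q ≤-refl))
      (sym (trans (cong (detour i) (trans (sym w+w≡1+w+[w∸1]) (sym (+-identityʳ (w + w))))) (detour-P⁺ 0)))
      (inj₂ (refl , I≡ , inj₂ (cong suc (+-identityʳ w) , refl)))

  detour-E : ∀ {i s} → I i ≡ true → s < detourLen → E B (detour i s) (detour i (suc s))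
  detour-E {i} {s} I≡ s< with detourView s
  ... | on-P⁻ {a} a<w with m≤n⇒m<n∨m≡n a<w
  ...   | inj₁ 1+a<w rewrite detour-P⁻ {i} a<w | detour-P⁻ {i} 1+a<w =
          P-edge (≤-trans (<⇒≤ 1+a<w) (m≤m+n w w)) (λ _ → <⇒≢ a<w , <⇒≢ 1+a<w)
  ...   | inj₂ 1+a≡w = subst (λ n → E B (detour i n) (detour i (suc n))) (sym (suc-injective 1+a≡w)) (junction-PQ I≡)
  detour-E {i} {s} I≡ s< | on-Q {a} a<w with m≤n⇒m<n∨m≡n a<w
  ...   | inj₁ 1+a<w = subst (λ n → E B (detour i (w + a)) (detour i n)) (+-suc w a) Q-edge
    where
    Q-edge : E B (detour i (w + a)) (detour i (w + suc a))
    Q-edge rewrite detour-Q {i} a<w | detour-Q {i} 1+a<w = inj₁ (refl , I≡ , refl , ≤-pred 1+a<w)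
  ...   | inj₂ 1+a≡w = subst (λ n → E B (detour i (w + n)) (detour i (suc (w + n))))
                         (sym (suc-injective 1+a≡w)) (junction-QP I≡)
  detour-E {i} {s} I≡ s< | on-P⁺ b = subst (λ n → E B (detour i (w + w + b)) (detour i n)) (+-suc (w + w) b) P-step
    where
    b<w∸1 : b < w ∸ 1
    b<w∸1 = +-cancelˡ-< (w + w) _ _ s<
    P-step : E B (detour i (w + w + b)) (detour i (w + w + suc b))
    P-step rewrite detour-P⁺ {i} b | detour-P⁺ {i} (suc b) =
      subst (λ n → E B (pv i (suc (w + b))) (pv i (suc n))) (sym (+-suc w b))
        (P-edge (subst (_≤ w + w) (cong suc (+-suc w b)) (P⁺-bound b<w∸1))
                (λ _ → >⇒≢ (s≤s (m≤m+n w b)) , >⇒≢ (s≤s (≤-trans (m≤m+n w b) (n≤1+n _)))))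

  detour-onto-pv : ∀ {i a} → I i ≡ true → V B (pv i a) → ∃[ s ] (s ≤ detourLen × detour i s ≡ pv i a)
  detour-onto-pv {i} {a} I≡ (a≤ , a≢w) with a <? w
  ... | yes a<w = a , ≤-trans (<⇒≤ a<w) (≤-trans (m≤m+n w w) (m≤m+n (w + w) _)) , detour-P⁻ a<w
  ... | no a≮w  = w + w + b , +-monoʳ-≤ (w + w) b≤w∸1 , trans (detour-P⁺ b) (cong (pv i) 1+w+b≡a)
    where
    w<a : w < a
    w<a = ≤∧≢⇒< (≮⇒≥ a≮w) (λ w≡a → a≢w I≡ (sym w≡a))
    b : ℕ
    b = a ∸ suc w
    1+w+b≡a : suc (w + b) ≡ a
    1+w+b≡a = m+[n∸m]≡n w<a
    b≤w∸1 : b ≤ w ∸ 1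
    b≤w∸1 = +-cancelˡ-≤ w _ _ (≤-pred (subst₂ _≤_ (sym 1+w+b≡a) w+w≡1+w+[w∸1] (subst (a ≤_) 2t∸6≡w+w a≤)))

  detour-onto-qv : ∀ {i b} → V B (qv i b) → ∃[ s ] (s ≤ detourLen × detour i s ≡ qv i b)
  detour-onto-qv {i} {b} (_ , b≤) =
    w + b , ≤-trans (+-monoʳ-≤ w (≤-trans b≤ (n≤1+n _))) (m≤m+n (w + w) _) , detour-Q (s≤s b≤)

  route : Fin k → Bool → ℕ → Vertex
  route i false = pv i
  route i true  = detour i

  routeLen : Bool → ℕ
  routeLen false = w + w
  routeLen true  = detourLen

  route-start : ∀ i b → route i b 0 ≡ pv i 0
  route-start i false = refl
  route-start i true  = detour-start

  route-end : ∀ i b → route i b (routeLen b) ≡ pv i (w + w)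
  route-end i false = refl
  route-end i true  = detour-end

  routeLen<3t : ∀ b → routeLen b < 3 * t
  routeLen<3t true  = subst (detourLen <_) (sym (three-t r)) (m≤n+m _ 9)
    where
    three-t : ∀ r → 3 * (5 + r) ≡ 9 + suc (suc (suc r) + suc (suc r) + suc r)
    three-t = solve-∀
  routeLen<3t false = ≤-trans (s≤s (m≤m+n (w + w) _)) (routeLen<3t true)

  record Fibre (p n : ℕ) (h : ℕ → Vertex) : Set where
    field
      path  : IsPathFn B n h
      over  : ∀ {s} → s ≤ n → π (h s) ≡ (m , p)
      onto  : ∀ {v} → V B v → π v ≡ (m , p) → ∃[ s ] (s ≤ n × h s ≡ v)
      short : n < 3 * t

  Fibre-reverse : ∀ {p n h} → Fibre p n h → Fibre p n (λ s → h (n ∸ s))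
  Fibre-reverse {p} {n} {h} F = record
    { path  = IsPathFn-reverse B-sym path
    ; over  = λ {s} _ → over (m∸n≤m n s)
    ; onto  = λ vB π≡ → let s , s≤n , hs≡v = onto vB π≡ in
                n ∸ s , m∸n≤m n s , trans (cong h (m∸[m∸n]≡n s≤n)) hs≡v
    ; short = short
    }
    where open Fibre F

  on-R : ∀ {i p v} → x i ≡ (m , p) → V B v → π v ≡ (m , p) → (∃[ a ] v ≡ pv i a) ⊎ (∃[ b ] v ≡ qv i b)
  on-R {i} {v = old a}  xi≡ (_ , ∉) π≡ = ⊥-elim (∉ i (trans π≡ (sym xi≡)))
  on-R {i} {v = pv j a} xi≡ _ π≡ with x-inj j i (trans π≡ (sym xi≡))
  ... | refl = inj₁ (a , refl)
  on-R {i} {v = qv j b} xi≡ _ π≡ with x-inj j i (trans π≡ (sym xi≡))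
  ... | refl = inj₂ (b , refl)

  route-Fibre : ∀ {i p} → x i ≡ (m , p) → Fibre p (routeLen (I i)) (route i (I i))
  route-Fibre {i} {p} xi≡ with I i in I≡
  ... | false = record
    { path  = record
      { vertex    = λ {s} s≤ → subst (s ≤_) (sym 2t∸6≡w+w) s≤ , ⊥-elim ∘ I≢true
      ; injective = λ _ _ → pv-index
      ; edge      = λ s< → P-edge s< (⊥-elim ∘ I≢true)
      }
    ; over  = λ _ → xi≡
    ; onto  = onto
    ; short = routeLen<3t false
    }
    where
    I≢true : I i ≢ true
    I≢true I≡true with trans (sym I≡) I≡true
    ... | ()
    onto : ∀ {v} → V B v → π v ≡ (m , p) → ∃[ s ] (s ≤ w + w × pv i s ≡ v)
    onto vB π≡ with on-R xi≡ vB π≡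
    ... | inj₁ (a , refl) = a , subst (a ≤_) 2t∸6≡w+w (proj₁ vB) , refl
    ... | inj₂ (b , refl) = ⊥-elim (I≢true (proj₁ vB))
  ... | true = record
    { path  = record
      { vertex    = detour-V I≡
      ; injective = λ {s} {s'} _ _ → detour-injective s s'
      ; edge      = detour-E I≡
      }
    ; over  = λ {s} _ → trans (detour-π i s) xi≡
    ; onto  = onto
    ; short = routeLen<3t true
    }
    where
    onto : ∀ {v} → V B v → π v ≡ (m , p) → ∃[ s ] (s ≤ detourLen × detour i s ≡ v)
    onto vB π≡ with on-R xi≡ vB π≡
    ... | inj₁ (a , refl) = detour-onto-pv I≡ vB
    ... | inj₂ (b , refl) = detour-onto-qv vB

  -- R_i, oriented so that it ends next to (m , next p).
  leg : ℕ → Fin k → ℕ → Vertex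
  leg p i with x⁻ i ≟² (m , next p)
  ... | yes _ = λ s → route i (I i) (routeLen (I i) ∸ s)
  ... | no _  = route i (I i)

  fibre : ℕ → ℕ → Vertex
  fibre p with find p
  ... | inj₁ (i , _) = leg p i
  ... | inj₂ _       = λ _ → old (m , p)

  fibreLen : ℕ → ℕ
  fibreLen p with find p
  ... | inj₁ (i , _) = routeLen (I i)
  ... | inj₂ _       = 0

  fibre-Fibre : ∀ {p} → p < N → Fibre p (fibreLen p) (fibre p)
  fibre-Fibre {p} p<N with find p
  ... | inj₂ ∉ = record
    { path  = record
      { vertex    = λ _ → (refl , p<N) , λ i eq → ∉ i (sym eq)
      ; injective = λ { z≤n z≤n _ → refl }
      ; edge      = λ ()
      }
    ; over  = λ _ → refl
    ; onto  = onto
    ; short = s≤s z≤n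
    }
    where
    onto : ∀ {v} → V B v → π v ≡ (m , p) → ∃[ s ] (s ≤ 0 × old (m , p) ≡ v)
    onto {old _}  _ π≡ = 0 , z≤n , cong old (sym π≡)
    onto {pv i _} _ π≡ = ⊥-elim (∉ i π≡)
    onto {qv i _} _ π≡ = ⊥-elim (∉ i π≡)
  ... | inj₁ (i , xi≡) with x⁻ i ≟² (m , next p)
  ...   | yes _ = Fibre-reverse (route-Fibre xi≡)
  ...   | no _  = route-Fibre xi≡

  leg-end : ∀ {p i} → x i ≡ (m , p) → p < N → E B (leg p i (routeLen (I i))) (old (m , next p))
  leg-end {p} {i} xi≡ p<N with x⁻ i ≟² (m , next p)
  ... | yes x⁻≡ = subst (λ v → E B v _)
                    (sym (trans (cong (route i (I i)) (n∸n≡0 (routeLen (I i)))) (route-start i (I i))))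
                    (inj₂ (inj₁ (sym x⁻≡ , refl)))
  ... | no x⁻≢  = subst (λ v → E B v _) (sym (route-end i (I i)))
                    (inj₂ (inj₂ (sym (x⁺-next xi≡ p<N x⁻≢) , sym 2t∸6≡w+w)))

  leg-start : ∀ {p j} → x j ≡ (m , next p) → p < N → E B (old (m , p)) (leg (next p) j 0)
  leg-start {p} {j} xj≡ p<N with x⁻ j ≟² (m , next (next p))
  ... | yes x⁻≡ = subst (E B (old (m , p))) (sym (route-end j (I j)))
                    (inj₁ (inj₂ (sym x⁺≡ , sym 2t∸6≡w+w)))
    where
    x⁺≡ : x⁺ j ≡ (m , p)
    x⁺≡ = neighbour-previous xj≡ p<N (x⁺-adj j) (x⁻≢x⁺ j ∘ trans x⁻≡ ∘ sym)
  ... | no x⁻≢  = subst (E B (old (m , p))) (sym (route-start j (I j)))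
                    (inj₁ (inj₁ (sym (neighbour-previous xj≡ p<N (x⁻-adj j) x⁻≢) , refl)))

  Bm-next : ∀ {p} → p < N → E (Bm t m) (m , p) (m , next p)
  Bm-next {p} p<N = (refl , p<N) , (refl , next<N p) , refl , CycAdj-next p<N

  fibre-joined : ∀ {p} → p < N → E B (fibre p (fibreLen p)) (fibre (next p) 0)
  fibre-joined {p} p<N with find p | find (next p)
  ... | inj₂ ∉ | inj₂ ∉' =
    inj₁ (Bm-next p<N , (proj₁ (Bm-next p<N) , λ i → ∉ i ∘ sym) , (proj₁ (proj₂ (Bm-next p<N)) , λ i → ∉' i ∘ sym))
  ... | inj₁ (i , xi≡) | inj₁ (j , xj≡) = ⊥-elim (x-stab i j (subst₂ (E (Bm t m)) (sym xi≡) (sym xj≡) (Bm-next p<N)))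
  ... | inj₁ (i , xi≡) | inj₂ _         = leg-end xi≡ p<N
  ... | inj₂ _         | inj₁ (j , xj≡) = leg-start xj≡ p<N

  open Chain B position fibre fibreLen

  fibre-IsSegment : ∀ {p} → p < N → IsSegment p
  fibre-IsSegment p<N = path , λ s≤ → cong proj₂ (over s≤)
    where open Fibre (fibre-Fibre p<N)

  cover : ∀ D c → ∃₂ λ z zs → IsPath B (z ∷ zs) × length zs < suc (D + D) * (3 * t)
                     × (∀ {v} → V B v → Near N D c (position v) → v ∈ z ∷ zs)
  cover D c = _ , _
            , chain-IsPath ps (arc-All origin len fibre-IsSegment) (arc-Unique origin len<N) (arc-Linked origin len fibre-joined)
            , (begin
                length (chain ps)    ≤⟨ length-chain ps (arc-All origin len (Fibre.short ∘ fibre-Fibre)) ⟩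
                length ps * (3 * t)  ≡⟨ cong (_* (3 * t)) (length-applyUpTo (λ i → (origin + i) % N) (suc len)) ⟩
                suc len * (3 * t)    ≤⟨ *-monoˡ-≤ (3 * t) (s≤s len≤) ⟩
                suc (D + D) * (3 * t) ∎)
            , covers′
    where
    open ArcAround (arcAround D c)
    open ≤-Reasoning
    ps : List ℕ
    ps = arc origin len
    covers′ : ∀ {v} → V B v → Near N D c (position v) → v ∈ chain ps
    covers′ vB close with B-onOuter vB
    ... | π≡ , p<N with Fibre.onto (fibre-Fibre p<N) vB π≡
    ...   | s , s≤ , fibre≡v = subst (_∈ chain ps) fibre≡v (chain-∈ (covers p<N close) s≤)

-- Canonical territories

n<m^n : ∀ {m} → 1 < m → ∀ n → n < m ^ n
n<m^n 1<m zero    = s≤s z≤n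
n<m^n 1<m (suc n) = ≤-<-trans (n<m^n 1<m n) (^-monoʳ-< _ 1<m (n<1+n n))

cover-bound : ∀ t → 3 ≤ t → ∀ e → suc (e * t ^ e + e * t ^ e) * (3 * t) ≤ t ^ (2 * suc e + 3 * t)
cover-bound t@(suc _) 3≤t e = begin
  suc (e * P + e * P) * (3 * t)        ≤⟨ *-monoˡ-≤ (3 * t) (+-mono-≤ 1≤PP (+-mono-≤ eP≤PP eP≤PP)) ⟩
  (P * P + (P * P + P * P)) * (3 * t)  ≡⟨ regroup (P * P) t ⟩
  P * P * (3 * 3 * t)                  ≤⟨ *-monoʳ-≤ (P * P) (*-monoˡ-≤ t (*-mono-≤ 3≤t 3≤t)) ⟩
  P * P * (t * t * t)                  ≡⟨ cong (P * P *_) (cube t) ⟩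
  P * P * t ^ 3                        ≤⟨ *-monoʳ-≤ (P * P) (^-monoʳ-≤ t {3} {2 + 3 * t} (s≤s (s≤s (s≤s z≤n)))) ⟩
  P * P * t ^ (2 + 3 * t)              ≡⟨ cong (_* t ^ (2 + 3 * t)) (sym (^-distribˡ-+-* t e e)) ⟩
  t ^ (e + e) * t ^ (2 + 3 * t)        ≡⟨ sym (^-distribˡ-+-* t (e + e) (2 + 3 * t)) ⟩
  t ^ (e + e + (2 + 3 * t))            ≡⟨ cong (t ^_) (exponent e t) ⟩
  t ^ (2 * suc e + 3 * t)              ∎
  where
  open ≤-Reasoning
  P : ℕ
  P = t ^ e
  1≤PP : 1 ≤ P * P
  1≤PP = *-mono-≤ (m^n>0 t e) (m^n>0 t e)
  eP≤PP : e * P ≤ P * P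
  eP≤PP = *-monoˡ-≤ P (<⇒≤ (n<m^n (≤-trans (s≤s (s≤s z≤n)) 3≤t) e))
  regroup : ∀ x t → (x + (x + x)) * (3 * t) ≡ x * (3 * 3 * t)
  regroup = solve-∀
  cube : ∀ t → t * t * t ≡ t ^ 3
  cube t = trans (*-assoc t t t) (cong (λ y → t * (t * y)) (sym (*-identityʳ t)))
  exponent : ∀ e t → e + e + (2 + 3 * t) ≡ 2 * suc e + 3 * t
  exponent = solve-∀

module CanonicalTerritory
  (r m : ℕ) (D : Expansion (5 + r) (Tm (5 + r) m) (Bm (5 + r) m))
  {A : Set} {Tᴬ Kᴬ : Graph A} (K⊆T : SubGraph Kᴬ Tᴬ) (φ : Iso Tᴬ (ExpT (5 + r) D))
  (φ-V : ∀ x p → V Kᴬ x ⇔ V (ExpB (5 + r) D) (f φ x p))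
  (φ-E : ∀ x y p q → E Kᴬ x y ⇔ E (ExpB (5 + r) D) (f φ x p) (f φ y q))
  where

  open Fibres r m D
  open Equivalence

  f-cong : ∀ {y y'} → y ≡ y' → ∀ p p' → f φ y p ≡ f φ y' p'
  f-cong refl = f-irr φ _

  φ⁻¹ : (v : Vertex) → V B v → A
  φ⁻¹ v vB = g φ v (B⊆T vB)

  φ⁻¹-V : ∀ v vB → V Kᴬ (φ⁻¹ v vB)
  φ⁻¹-V v vB = from (φ-V _ (g-V φ v _)) (subst (V B) (sym (fg φ v _)) vB)

  φ⁻¹-E : ∀ {v v'} vB vB' → E B v v' → E Kᴬ (φ⁻¹ v vB) (φ⁻¹ v' vB')
  φ⁻¹-E {v} {v'} _ _ e = from (φ-E _ _ (g-V φ v _) (g-V φ v' _)) (subst₂ (E B) (sym (fg φ v _)) (sym (fg φ v' _)) e)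

  φ⁻¹-injective : ∀ {v v'} vB vB' → φ⁻¹ v vB ≡ φ⁻¹ v' vB' → v ≡ v'
  φ⁻¹-injective {v} {v'} _ _ eq = trans (sym (fg φ v _)) (trans (f-cong eq _ _) (fg φ v' _))

  φ⁻¹-f : ∀ x px vB → φ⁻¹ (f φ x px) vB ≡ x
  φ⁻¹-f x px _ = trans (g-irr φ _ _ _) (gf φ x px)

  pull-back : ∀ {z zs} → IsPath B (z ∷ zs) → ∃₂ λ a ys → IsPath Kᴬ (a ∷ ys) × length ys ≡ length zs
              × (∀ {v} vB → v ∈ z ∷ zs → φ⁻¹ v vB ∈ a ∷ ys)
  pull-back {z} {zs} (vz ∷ vzs , unique , linked) =
    φ⁻¹ z vz , mapWithAll φ⁻¹ zs vzs ,
    ( mapWithAll-All φ⁻¹ φ⁻¹-V (z ∷ zs) (vz ∷ vzs)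
    , mapWithAll-Unique φ⁻¹ φ⁻¹-injective (z ∷ zs) (vz ∷ vzs) unique
    , mapWithAll-Linked φ⁻¹ φ⁻¹-E (z ∷ zs) (vz ∷ vzs) linked ) ,
    length-mapWithAll φ⁻¹ zs vzs ,
    λ vB v∈ → mapWithAll-∈ φ⁻¹ (λ v _ _ → g-irr φ v _ _) vB (z ∷ zs) (vz ∷ vzs) v∈

  project : (y : A) → V Tᴬ y → ℕ × ℕ
  project y py = π (f φ y py)

  close⇒near : ∀ {u x e} pu px → DistLt Tᴬ u x (suc e)
    → Near N (drift e) (centre (project u pu)) (position (f φ x (proj₁ K⊆T x px)))
  close⇒near {u} {x} {e} pu px (ws , (pu' ∷ pws , _ , walk) , last≡ , len<) =
    Near-mono (drift-mono len≤e)
      (subst (λ c → Near N (drift L) c b) centre≡ (Reach.nearby (reach-walk _ _ projected-walk projected-last)))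
    where
    px' : V Tᴬ x
    px' = proj₁ K⊆T x px
    b L : ℕ
    b = position (f φ x px')
    L = length (mapWithAll project ws pws)
    projected-walk : Linked StepOrStay (mapWithAll project (u ∷ ws) (pu' ∷ pws))
    projected-walk = mapWithAll-Linked project
      (λ {y} {y'} py py' e → π-E {f φ y py} {f φ y' py'} (to (f-E φ y y' py py') e)) (u ∷ ws) (pu' ∷ pws) walk
    projected-last : lastOf (project u pu') (mapWithAll project ws pws) ≡ (m , position (f φ x px'))
    projected-last = trans
      (lastOf-mapWithAll project (λ y _ _ → cong π (f-irr φ y _ _)) u pu' ws pws (subst (V Tᴬ) (sym last≡) px'))
                           (trans (cong π (f-cong last≡ _ px')) (proj₁ (B-onOuter (to (φ-V x px') px))))
    len≤e : length (mapWithAll project ws pws) ≤ e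
    len≤e = subst (_≤ e) (sym (length-mapWithAll project ws pws)) (≤-pred len<)
    centre≡ : centre (project u pu') ≡ centre (project u pu)
    centre≡ = cong (centre ∘ π) (f-irr φ u pu' pu)

  ball-in-path : ∀ e u → V Tᴬ u
    → ∃[ a ] ∃[ ys ] (IsPath Kᴬ (a ∷ ys) × length ys ≤ (5 + r) ^ (2 * suc e + 3 * (5 + r))
                   × (∀ x → V Kᴬ x → DistLt Tᴬ u x (suc e) → x ∈ a ∷ ys))
  ball-in-path e u pu =
    let _ , _ , pathB , lenB , coversB = cover (drift e) (centre (project u pu))
        a , ys , pathK , len≡ , ∈K     = pull-back pathB
    in  a , ys , pathK
      , ≤-trans (<⇒≤ (subst (_< _) (sym len≡) lenB)) (cover-bound (5 + r) (s≤s (s≤s (s≤s z≤n))) e)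
      , λ x px close → let vB = to (φ-V x (proj₁ K⊆T x px)) px in
          subst (_∈ a ∷ ys) (φ⁻¹-f x _ vB) (∈K vB (coversB vB (close⇒near pu px close)))

lemma6p3 : (t : ℕ) → 5 ≤ t → {A : Set}
    → (Γ Ω : Graph A) (M₁ M₂ : A → A → Set)
    → IsGraph Γ → Cubic Γ → GirthAtLeast Γ (t ^ (5 * t))
    → HamiltonianCycle Γ Ω
    → PerfectMatching Γ M₁ → PerfectMatching Γ M₂ → EdgePartition Ω M₁ M₂
    → (J : Set) (K T : J → Graph A)
    → (∀ j → InCalK Γ Ω M₁ M₂ (K j))
    → (∀ K' → InCalK Γ Ω M₁ M₂ K' → ∃[ j ] SameGraph (K j) K')
    → (∀ j j' → SameGraph (K j) (K j') → j ≡ j')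
    → (∀ j → IsGraph (T j))
    → (∀ j → IsCanonical t (T j) (K j))
    → (∀ j x → (V (T j) x × V Γ x) ⇔ V (K j) x)
    → (∀ j j' → j ≢ j' → ∀ x → (V (T j) x × V (T j') x) ⇔ (V (K j) x × V (K j') x))
    → (d : ℕ) → 1 ≤ d → (j : J) → (u : A) → V (T j) u
    → ∃[ a ] ∃[ ys ] (IsPath (K j) (a ∷ ys) × length ys ≤ t ^ (2 * d + 3 * t)
        × (∀ x → V (K j) x → DistLt (T j) u x d → x ∈ a ∷ ys))
-- Only the canonicity of (T j , K j) is used.
lemma6p3 .(5 + r) (s≤s (s≤s (s≤s (s≤s (s≤s (z≤n {r}))))))
  _ _ _ _ _ _ _ _ _ _ _ _ K T _ _ _ _ canonical _ _ (suc e) _ j u pu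
  with canonical j
... | K⊆T , m , D , φ , φ-V , φ-E = CanonicalTerritory.ball-in-path r m D K⊆T φ φ-V φ-E e u pu
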